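{- The weak $\lambda$-calculus is confluent: if $M\twoheadrightarrow N_1$ and $M\twoheadrightarrow N_2$, then there is a term $P$ with $N_1\twoheadrightarrow P$ and $N_2\twoheadrightarrow P$.
   Context: Terms: $M ::= x\mid M\,M\mid\lambda x.M$, up to renaming of bound variables; $M[x:=N]$ is capture-avoiding substitution. For a one-hole context $C$, $\mathrm{bPath}(C)$ is the set of variables bound by abstractions above the hole. Weak reduction $\to$ is defined by $C[(\lambda x.M)\,N]\to C[M[x:=N]]$ whenever no free variable of $(\lambda x.M)\,N$ belongs to $\mathrm{bPath}(C)$ (equivalently: $\beta$-reduction closed under application contexts and under abstraction $\lambda x$ only when $x$ is not free in the contracted redex). $\twoheadrightarrow$ is the reflexive–transitive closure of $\to$. -}

module Defs where

open import Data.Nat using (ℕ; zero; suc; _<_; _≤_; _+_; _∸_; _≟_)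
open import Data.Nat.Properties using (_<?_)
open import Relation.Nullary using (yes; no; ¬_)
open import Data.Empty using (⊥)
open import Relation.Binary.Construct.Closure.ReflexiveTransitive using (Star)

-- λ-terms up to α-equivalence, as de Bruijn terms (index 0 = innermost binder).
data Term : Set where
  var  : ℕ → Term
  _·_  : Term → Term → Term
  ƛ_   : Term → Term

infixl 7 _·_
infix  6 ƛ_

data FreeIn : ℕ → Term → Set where
  fv   : ∀ {x} → FreeIn x (var x)
  fl   : ∀ {x M N} → FreeIn x M → FreeIn x (M · N)
  fr   : ∀ {x M N} → FreeIn x N → FreeIn x (M · N)
  fλ   : ∀ {x M} → FreeIn (suc x) M → FreeIn x (ƛ M)

shift : ℕ → ℕ → Term → Term
shift d c (var x) with x <? c
... | yes _ = var x
... | no  _ = var (x + d)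
shift d c (M · N) = shift d c M · shift d c N
shift d c (ƛ M)   = ƛ shift d (suc c) M

-- subst j N M : replace index j by N in M, decrementing indices above j
-- (N is given relative to the context outside the binder that is removed).
subst : ℕ → Term → Term → Term
subst j N (var x) with x ≟ j
... | yes _ = shift j 0 N
... | no  _ with x <? j
...   | yes _ = var x
...   | no  _ = var (x ∸ 1)
subst j N (M · M') = subst j N M · subst j N M'
subst j N (ƛ M)    = ƛ subst (suc j) N M

_[_] : Term → Term → Term
M [ N ] = subst 0 N M

-- M ⟶[ d ] M' : one weak step at a position with d binders (bPath) above it,
-- relative to the enclosing position. The contracted redex R must have no free
-- variable bound on the path, i.e. no free index < d (indices relative to R).
data _⟶[_]_ : Term → ℕ → Term → Set where
  β    : ∀ {d M N} →
         (∀ x → x < d → FreeIn x ((ƛ M) · N) → ⊥) →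
         ((ƛ M) · N) ⟶[ d ] (M [ N ])
  appL : ∀ {d M M' N} → M ⟶[ d ] M' → (M · N) ⟶[ d ] (M' · N)
  appR : ∀ {d M N N'} → N ⟶[ d ] N' → (M · N) ⟶[ d ] (M · N')
  lam  : ∀ {d M M'} → M ⟶[ suc d ] M' → (ƛ M) ⟶[ d ] (ƛ M')

-- weak reduction: at the root of the whole term, bPath starts empty
_⟶_ : Term → Term → Set
M ⟶ N = M ⟶[ 0 ] N

_↠_ : Term → Term → Set
_↠_ = Star _⟶_

infix 4 _⟶_ _↠_ _⟶[_]_

-- Tait–Martin-Löf–Takahashi, adapted to weak reduction. Parallel weak reduction
-- ⇛[ d ] may contract, simultaneously, any redexes whose free variables avoid the
-- d binders above them, and every term M has a complete development dev d M with
-- M' ⇛[ d ] dev d M whenever M ⇛[ d ] M'. This triangle property makes ⇛[ d ]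
-- confluent, and ⟶[ d ] ⊆ ⇛[ d ] ⊆ ⟶[ d ]* transfers confluence to weak reduction.
-- The one new point is the substitution lemma: in M[0 := N] under d binders, a redex
-- of M that is contracted never contains the variable 0, so N is never inside a
-- contracted redex and no side condition on N is needed.
module Submission where

open import Defs
open import Data.Product using (Σ; _×_; _,_)
open import Data.Nat using (ℕ; zero; suc; _<_; _≤_; _+_; _∸_; _≟_; z≤n; s≤s)
open import Data.Nat.Properties
  using (_<?_; _≤?_; ≰⇒>; <-cmp; <-irrefl; <-asym; +-suc; +-identityʳ; ≤-trans; allUpTo?)
open import Data.Empty using (⊥-elim)
open import Function using (_∘_)
open import Relation.Nullary using (yes; no; ¬_; Dec; ¬?)
open import Relation.Nullary.Decidable using (map′)
open import Relation.Binary using (Rel; tri<; tri≈; tri>)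
open import Relation.Binary.PropositionalEquality
  using (_≡_; refl; sym; trans; cong; cong₂; _≗_; module ≡-Reasoning)
  renaming (subst to transport; subst₂ to transport₂)
open import Relation.Binary.Construct.Closure.ReflexiveTransitive
  using (Star; ε; _◅_; _◅◅_; gmap; map; _⋆)
open import Relation.Binary.Rewriting using (Confluent)

-- Renamings and simultaneous substitutions

Renaming : Set
Renaming = ℕ → ℕ

Substitution : Set
Substitution = ℕ → Term

ext : Renaming → Renaming
ext ρ zero    = zero
ext ρ (suc x) = suc (ρ x)

ren : Renaming → Term → Term
ren ρ (var x) = var (ρ x)
ren ρ (M · N) = ren ρ M · ren ρ N
ren ρ (ƛ M)   = ƛ ren (ext ρ) M

exts : Substitution → Substitution
exts σ zero    = var zero
exts σ (suc x) = ren suc (σ x)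

sub : Substitution → Term → Term
sub σ (var x) = σ x
sub σ (M · N) = sub σ M · sub σ N
sub σ (ƛ M)   = ƛ sub (exts σ) M

single : Term → Substitution
single N zero    = N
single N (suc x) = var x

ext-cong : ∀ {ρ ρ'} → ρ ≗ ρ' → ext ρ ≗ ext ρ'
ext-cong h zero    = refl
ext-cong h (suc x) = cong suc (h x)

ren-cong : ∀ {ρ ρ'} → ρ ≗ ρ' → ren ρ ≗ ren ρ'
ren-cong h (var x) = cong var (h x)
ren-cong h (M · N) = cong₂ _·_ (ren-cong h M) (ren-cong h N)
ren-cong h (ƛ M)   = cong ƛ_ (ren-cong (ext-cong h) M)

exts-cong : ∀ {σ σ'} → σ ≗ σ' → exts σ ≗ exts σ'
exts-cong h zero    = refl
exts-cong h (suc x) = cong (ren suc) (h x)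

sub-cong : ∀ {σ σ'} → σ ≗ σ' → sub σ ≗ sub σ'
sub-cong h (var x) = h x
sub-cong h (M · N) = cong₂ _·_ (sub-cong h M) (sub-cong h N)
sub-cong h (ƛ M)   = cong ƛ_ (sub-cong (exts-cong h) M)

ren-ren : ∀ ρ ρ' M → ren ρ (ren ρ' M) ≡ ren (ρ ∘ ρ') M
ren-ren ρ ρ' (var x) = refl
ren-ren ρ ρ' (M · N) = cong₂ _·_ (ren-ren ρ ρ' M) (ren-ren ρ ρ' N)
ren-ren ρ ρ' (ƛ M)   =
  cong ƛ_ (trans (ren-ren (ext ρ) (ext ρ') M) (ren-cong ext-∘ M))
  where
  ext-∘ : ext ρ ∘ ext ρ' ≗ ext (ρ ∘ ρ')
  ext-∘ zero    = refl
  ext-∘ (suc x) = refl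

sub-ren : ∀ σ ρ M → sub σ (ren ρ M) ≡ sub (σ ∘ ρ) M
sub-ren σ ρ (var x) = refl
sub-ren σ ρ (M · N) = cong₂ _·_ (sub-ren σ ρ M) (sub-ren σ ρ N)
sub-ren σ ρ (ƛ M)   =
  cong ƛ_ (trans (sub-ren (exts σ) (ext ρ) M) (sub-cong exts-∘ M))
  where
  exts-∘ : exts σ ∘ ext ρ ≗ exts (σ ∘ ρ)
  exts-∘ zero    = refl
  exts-∘ (suc x) = refl

ren-sub : ∀ ρ σ M → ren ρ (sub σ M) ≡ sub (ren ρ ∘ σ) M
ren-sub ρ σ (var x) = refl
ren-sub ρ σ (M · N) = cong₂ _·_ (ren-sub ρ σ M) (ren-sub ρ σ N)
ren-sub ρ σ (ƛ M)   =
  cong ƛ_ (trans (ren-sub (ext ρ) (exts σ) M) (sub-cong ext-exts M))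
  where
  ext-exts : ren (ext ρ) ∘ exts σ ≗ exts (ren ρ ∘ σ)
  ext-exts zero    = refl
  ext-exts (suc x) = trans (ren-ren (ext ρ) suc (σ x)) (sym (ren-ren suc ρ (σ x)))

sub-sub : ∀ τ σ M → sub τ (sub σ M) ≡ sub (sub τ ∘ σ) M
sub-sub τ σ (var x) = refl
sub-sub τ σ (M · N) = cong₂ _·_ (sub-sub τ σ M) (sub-sub τ σ N)
sub-sub τ σ (ƛ M)   =
  cong ƛ_ (trans (sub-sub (exts τ) (exts σ) M) (sub-cong exts-exts M))
  where
  exts-exts : sub (exts τ) ∘ exts σ ≗ exts (sub τ ∘ σ)
  exts-exts zero    = refl
  exts-exts (suc x) = trans (sub-ren (exts τ) suc (σ x)) (sym (ren-sub suc τ (σ x)))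

sub-var : ∀ M → sub var M ≡ M
sub-var (var x) = refl
sub-var (M · N) = cong₂ _·_ (sub-var M) (sub-var N)
sub-var (ƛ M)   = cong ƛ_ (trans (sub-cong exts-var M) (sub-var M))
  where
  exts-var : exts var ≗ var
  exts-var zero    = refl
  exts-var (suc x) = refl

ren-single : ∀ ρ N M → ren ρ (sub (single N) M) ≡ sub (single (ren ρ N)) (ren (ext ρ) M)
ren-single ρ N M = begin
  ren ρ (sub (single N) M)                   ≡⟨ ren-sub ρ (single N) M ⟩
  sub (ren ρ ∘ single N) M                   ≡⟨ sub-cong pointwise M ⟩
  sub (single (ren ρ N) ∘ ext ρ) M           ≡⟨ sub-ren (single (ren ρ N)) (ext ρ) M ⟨
  sub (single (ren ρ N)) (ren (ext ρ) M)     ∎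
  where
  open ≡-Reasoning
  pointwise : ren ρ ∘ single N ≗ single (ren ρ N) ∘ ext ρ
  pointwise zero    = refl
  pointwise (suc x) = refl

sub-single : ∀ σ N M → sub σ (sub (single N) M) ≡ sub (single (sub σ N)) (sub (exts σ) M)
sub-single σ N M = begin
  sub σ (sub (single N) M)                   ≡⟨ sub-sub σ (single N) M ⟩
  sub (sub σ ∘ single N) M                   ≡⟨ sub-cong pointwise M ⟩
  sub (sub (single (sub σ N)) ∘ exts σ) M    ≡⟨ sub-sub (single (sub σ N)) (exts σ) M ⟨
  sub (single (sub σ N)) (sub (exts σ) M)    ∎
  where
  open ≡-Reasoning
  pointwise : sub σ ∘ single N ≗ sub (single (sub σ N)) ∘ exts σ
  pointwise zero    = refl
  pointwise (suc x) = sym (trans (sub-ren (single (sub σ N)) suc (σ x)) (sub-var (σ x)))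

-- shift and subst as instances of ren and sub

shiftVar : ℕ → ℕ → Renaming
shiftVar d c x with x <? c
... | yes _ = x
... | no  _ = x + d

shiftVar-< : ∀ d c x → x < c → shiftVar d c x ≡ x
shiftVar-< d c x x<c with x <? c
... | yes _   = refl
... | no  x≮c = ⊥-elim (x≮c x<c)

shiftVar-≮ : ∀ d c x → ¬ x < c → shiftVar d c x ≡ x + d
shiftVar-≮ d c x x≮c with x <? c
... | yes x<c = ⊥-elim (x≮c x<c)
... | no  _   = refl

shiftVar-suc : ∀ d c → shiftVar d (suc c) ≗ ext (shiftVar d c)
shiftVar-suc d c zero = shiftVar-< d (suc c) zero (s≤s z≤n)
shiftVar-suc d c (suc x) with x <? c
... | yes x<c = shiftVar-< d (suc c) (suc x) (s≤s x<c)
... | no  x≮c = shiftVar-≮ d (suc c) (suc x) λ { (s≤s x<c) → x≮c x<c }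

shift≡ren : ∀ d c M → shift d c M ≡ ren (shiftVar d c) M
shift≡ren d c (var x) with x <? c
... | yes _ = refl
... | no  _ = refl
shift≡ren d c (M · N) = cong₂ _·_ (shift≡ren d c M) (shift≡ren d c N)
shift≡ren d c (ƛ M)   =
  cong ƛ_ (trans (shift≡ren d (suc c) M) (ren-cong (shiftVar-suc d c) M))

shift-zero : ∀ c M → shift 0 c M ≡ M
shift-zero c (var x) with x <? c
... | yes _ = refl
... | no  _ = cong var (+-identityʳ x)
shift-zero c (M · N) = cong₂ _·_ (shift-zero c M) (shift-zero c N)
shift-zero c (ƛ M)   = cong ƛ_ (shift-zero (suc c) M)

shift-suc : ∀ j N → shift (suc j) 0 N ≡ ren suc (shift j 0 N)
shift-suc j N = begin
  shift (suc j) 0 N                 ≡⟨ shift≡ren (suc j) 0 N ⟩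
  ren (shiftVar (suc j) 0) N        ≡⟨ ren-cong pointwise N ⟩
  ren (suc ∘ shiftVar j 0) N        ≡⟨ ren-ren suc (shiftVar j 0) N ⟨
  ren suc (ren (shiftVar j 0) N)    ≡⟨ cong (ren suc) (shift≡ren j 0 N) ⟨
  ren suc (shift j 0 N)             ∎
  where
  open ≡-Reasoning
  pointwise : shiftVar (suc j) 0 ≗ suc ∘ shiftVar j 0
  pointwise x = trans (shiftVar-≮ (suc j) 0 x λ ())
                      (trans (+-suc x j) (cong suc (sym (shiftVar-≮ j 0 x λ ()))))

subst-var-≡ : ∀ j N → subst j N (var j) ≡ shift j 0 N
subst-var-≡ j N with j ≟ j
... | yes _   = refl
... | no  j≢j = ⊥-elim (j≢j refl)

subst-var-< : ∀ {j x} N → x < j → subst j N (var x) ≡ var x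
subst-var-< {j} {x} N x<j with x ≟ j
... | yes refl = ⊥-elim (<-irrefl refl x<j)
... | no  _ with x <? j
...   | yes _   = refl
...   | no  x≮j = ⊥-elim (x≮j x<j)

subst-var-> : ∀ {j x} N → j < x → subst j N (var x) ≡ var (x ∸ 1)
subst-var-> {j} {x} N j<x with x ≟ j
... | yes refl = ⊥-elim (<-irrefl refl j<x)
... | no  _ with x <? j
...   | yes x<j = ⊥-elim (<-asym x<j j<x)
...   | no  _   = refl

substVar : ℕ → Term → Substitution
substVar j N x = subst j N (var x)

substVar-suc : ∀ j N → substVar (suc j) N ≗ exts (substVar j N)
substVar-suc j N zero = subst-var-< {suc j} N (s≤s z≤n)
substVar-suc j N (suc x) with <-cmp x j
... | tri< x<j _ _ = trans (subst-var-< N (s≤s x<j)) (cong (ren suc) (sym (subst-var-< N x<j)))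
... | tri≈ _ refl _ =
  trans (subst-var-≡ (suc x) N) (trans (shift-suc x N) (cong (ren suc) (sym (subst-var-≡ x N))))
... | tri> _ _ j<x@(s≤s _) =
  trans (subst-var-> N (s≤s j<x)) (cong (ren suc) (sym (subst-var-> N j<x)))

subst≡sub : ∀ j N M → subst j N M ≡ sub (substVar j N) M
subst≡sub j N (var x)  = refl
subst≡sub j N (M · M') = cong₂ _·_ (subst≡sub j N M) (subst≡sub j N M')
subst≡sub j N (ƛ M)    =
  cong ƛ_ (trans (subst≡sub (suc j) N M) (sub-cong (substVar-suc j N) M))

substVar-zero : ∀ N → substVar 0 N ≗ single N
substVar-zero N zero    = trans (subst-var-≡ 0 N) (shift-zero 0 N)
substVar-zero N (suc x) = subst-var-> N (s≤s z≤n)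

[]≡sub : ∀ M N → M [ N ] ≡ sub (single N) M
[]≡sub M N = trans (subst≡sub 0 N M) (sub-cong (substVar-zero N) M)

ren-[] : ∀ ρ M N → ren ρ (M [ N ]) ≡ ren (ext ρ) M [ ren ρ N ]
ren-[] ρ M N = begin
  ren ρ (M [ N ])                             ≡⟨ cong (ren ρ) ([]≡sub M N) ⟩
  ren ρ (sub (single N) M)                    ≡⟨ ren-single ρ N M ⟩
  sub (single (ren ρ N)) (ren (ext ρ) M)      ≡⟨ []≡sub (ren (ext ρ) M) (ren ρ N) ⟨
  ren (ext ρ) M [ ren ρ N ]                   ∎
  where open ≡-Reasoning

sub-[] : ∀ σ M N → sub σ (M [ N ]) ≡ sub (exts σ) M [ sub σ N ]
sub-[] σ M N = begin
  sub σ (M [ N ])                             ≡⟨ cong (sub σ) ([]≡sub M N) ⟩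
  sub σ (sub (single N) M)                    ≡⟨ sub-single σ N M ⟩
  sub (single (sub σ N)) (sub (exts σ) M)     ≡⟨ []≡sub (sub (exts σ) M) (sub σ N) ⟨
  sub (exts σ) M [ sub σ N ]                  ∎
  where open ≡-Reasoning

free-ren : ∀ {x} ρ M → FreeIn x (ren ρ M) → Σ ℕ λ y → x ≡ ρ y × FreeIn y M
free-ren ρ (var y) fv = y , refl , fv
free-ren ρ (M · N) (fl f) with free-ren ρ M f
... | y , refl , g = y , refl , fl g
free-ren ρ (M · N) (fr f) with free-ren ρ N f
... | y , refl , g = y , refl , fr g
free-ren ρ (ƛ M) (fλ f) with free-ren (ext ρ) M f
... | suc y , refl , g = y , refl , fλ g

free-sub : ∀ {x} σ M → FreeIn x (sub σ M) → Σ ℕ λ y → FreeIn y M × FreeIn x (σ y)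
free-sub σ (var y) f = y , fv , f
free-sub σ (M · N) (fl f) with free-sub σ M f
... | y , g , h = y , fl g , h
free-sub σ (M · N) (fr f) with free-sub σ N f
... | y , g , h = y , fr g , h
free-sub σ (ƛ M) (fλ f) with free-sub (exts σ) M f
... | suc y , g , h with free-ren suc (σ y) h
...   | _ , refl , k = y , fλ g , k

free? : ∀ x M → Dec (FreeIn x M)
free? x (var y) with x ≟ y
... | yes refl = yes fv
... | no  x≢y  = no λ { fv → x≢y refl }
free? x (M · N) with free? x M | free? x N
... | yes f | _     = yes (fl f)
... | no  _ | yes g = yes (fr g)
... | no ¬f | no ¬g = no λ { (fl f) → ¬f f ; (fr g) → ¬g g }
free? x (ƛ M) with free? (suc x) M
... | yes f = yes (fλ f)
... | no ¬f = no λ { (fλ f) → ¬f f }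

NoFreeBelow : ℕ → Term → Set
NoFreeBelow d M = ∀ x → x < d → ¬ FreeIn x M

noFreeBelow? : ∀ d M → Dec (NoFreeBelow d M)
noFreeBelow? d M =
  map′ (λ h x x<d → h x<d) (λ h {x} x<d → h x x<d) (allUpTo? (λ x → ¬? (free? x M)) d)

noFreeBelow-var : ∀ {d y} → d ≤ y → NoFreeBelow d (var y)
noFreeBelow-var d≤y x x<d fv = <-irrefl refl (≤-trans x<d d≤y)

noFreeBelow-ren : ∀ {d e ρ M} → (∀ x → d ≤ x → e ≤ ρ x) →
                  NoFreeBelow d M → NoFreeBelow e (ren ρ M)
noFreeBelow-ren {d} {M = M} ρ-mono nf x x<e f with free-ren _ M f
... | y , refl , g with d ≤? y
...   | yes d≤y = <-irrefl refl (≤-trans x<e (ρ-mono y d≤y))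
...   | no  d≰y = nf y (≰⇒> d≰y) g

noFreeBelow-sub : ∀ {d e σ M} → (∀ x → d ≤ x → NoFreeBelow e (σ x)) →
                  NoFreeBelow d M → NoFreeBelow e (sub σ M)
noFreeBelow-sub {d} {σ = σ} {M} σ-nf nf x x<e f with free-sub σ M f
... | y , g , h with d ≤? y
...   | yes d≤y = σ-nf y d≤y x x<e h
...   | no  d≰y = nf y (≰⇒> d≰y) g

-- Parallel weak reduction

data _⇛[_]_ : Term → ℕ → Term → Set where
  pvar : ∀ {d x} → var x ⇛[ d ] var x
  papp : ∀ {d M M' N N'} → M ⇛[ d ] M' → N ⇛[ d ] N' → (M · N) ⇛[ d ] (M' · N')
  plam : ∀ {d M M'} → M ⇛[ suc d ] M' → (ƛ M) ⇛[ d ] (ƛ M')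
  pβ   : ∀ {d M M' N N'} → NoFreeBelow d ((ƛ M) · N) →
         M ⇛[ suc d ] M' → N ⇛[ d ] N' → ((ƛ M) · N) ⇛[ d ] (M' [ N' ])

infix 4 _⇛[_]_

⇛-refl : ∀ {d} M → M ⇛[ d ] M
⇛-refl (var x) = pvar
⇛-refl (M · N) = papp (⇛-refl M) (⇛-refl N)
⇛-refl (ƛ M)   = plam (⇛-refl M)

⟶⇒⇛ : ∀ {d M N} → M ⟶[ d ] N → M ⇛[ d ] N
⟶⇒⇛ (β {M = M} {N} nf) = pβ nf (⇛-refl M) (⇛-refl N)
⟶⇒⇛ (appL {N = N} s)   = papp (⟶⇒⇛ s) (⇛-refl N)
⟶⇒⇛ (appR {M = M} s)   = papp (⇛-refl M) (⟶⇒⇛ s)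
⟶⇒⇛ (lam s)            = plam (⟶⇒⇛ s)

free-⇛⁻ : ∀ {d M M' x} → M ⇛[ d ] M' → FreeIn x M' → FreeIn x M
free-⇛⁻ pvar f              = f
free-⇛⁻ (papp p q) (fl f)   = fl (free-⇛⁻ p f)
free-⇛⁻ (papp p q) (fr f)   = fr (free-⇛⁻ q f)
free-⇛⁻ (plam p) (fλ f)     = fλ (free-⇛⁻ p f)
free-⇛⁻ {x = x} (pβ {M' = M'} {N' = N'} _ p q) f
  with free-sub (single N') M' (transport (FreeIn x) ([]≡sub M' N') f)
... | zero  , _ , h  = fr (free-⇛⁻ q h)
... | suc _ , g , fv = fl (fλ (free-⇛⁻ p g))

noFreeBelow-⇛ : ∀ {d e M M'} → M ⇛[ e ] M' → NoFreeBelow d M → NoFreeBelow d M'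
noFreeBelow-⇛ p nf x x<d f = nf x x<d (free-⇛⁻ p f)

⇛⇒⟶* : ∀ {d M N} → M ⇛[ d ] N → Star _⟶[ d ]_ M N
⇛⇒⟶* pvar = ε
⇛⇒⟶* (papp {M' = M'} {N = N} p q) =
  gmap (_· N) appL (⇛⇒⟶* p) ◅◅ gmap (M' ·_) appR (⇛⇒⟶* q)
⇛⇒⟶* (plam p) = gmap ƛ_ lam (⇛⇒⟶* p)
⇛⇒⟶* (pβ {M = M} {M'} {N} nf p q) =
  gmap (_· N) appL (gmap ƛ_ lam (⇛⇒⟶* p)) ◅◅ gmap ((ƛ M') ·_) appR (⇛⇒⟶* q) ◅◅
  β (noFreeBelow-⇛ (papp (plam p) q) nf) ◅ ε

ext-mono : ∀ {d e ρ} → (∀ x → d ≤ x → e ≤ ρ x) → ∀ x → suc d ≤ x → suc e ≤ ext ρ x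
ext-mono ρ-mono (suc x) (s≤s d≤x) = s≤s (ρ-mono x d≤x)

⇛-ren : ∀ {d e ρ M M'} → (∀ x → d ≤ x → e ≤ ρ x) → M ⇛[ d ] M' → ren ρ M ⇛[ e ] ren ρ M'
⇛-ren ρ-mono pvar       = pvar
⇛-ren ρ-mono (papp p q) = papp (⇛-ren ρ-mono p) (⇛-ren ρ-mono q)
⇛-ren ρ-mono (plam p)   = plam (⇛-ren (ext-mono ρ-mono) p)
⇛-ren {e = e} {ρ} ρ-mono (pβ {M = M} {M'} {N} {N'} nf p q) =
  transport (ren ρ ((ƛ M) · N) ⇛[ e ]_) (sym (ren-[] ρ M' N'))
    (pβ (noFreeBelow-ren ρ-mono nf) (⇛-ren (ext-mono ρ-mono) p) (⇛-ren ρ-mono q))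

exts-noFreeBelow : ∀ {d e σ} → (∀ x → d ≤ x → NoFreeBelow e (σ x)) →
                   ∀ x → suc d ≤ x → NoFreeBelow (suc e) (exts σ x)
exts-noFreeBelow σ-nf (suc x) (s≤s d≤x) = noFreeBelow-ren (λ _ → s≤s) (σ-nf x d≤x)

exts-⇛ : ∀ {e σ σ'} → (∀ x → σ x ⇛[ e ] σ' x) → ∀ x → exts σ x ⇛[ suc e ] exts σ' x
exts-⇛ σ⇛σ' zero    = pvar
exts-⇛ σ⇛σ' (suc x) = ⇛-ren (λ _ → s≤s) (σ⇛σ' x)

⇛-sub : ∀ {d e σ σ' M M'} → (∀ x → d ≤ x → NoFreeBelow e (σ x)) →
        (∀ x → σ x ⇛[ e ] σ' x) → M ⇛[ d ] M' → sub σ M ⇛[ e ] sub σ' M'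
⇛-sub σ-nf σ⇛σ' (pvar {x = x}) = σ⇛σ' x
⇛-sub σ-nf σ⇛σ' (papp p q)     = papp (⇛-sub σ-nf σ⇛σ' p) (⇛-sub σ-nf σ⇛σ' q)
⇛-sub σ-nf σ⇛σ' (plam p)       = plam (⇛-sub (exts-noFreeBelow σ-nf) (exts-⇛ σ⇛σ') p)
⇛-sub {e = e} {σ} {σ'} σ-nf σ⇛σ' (pβ {M = M} {M'} {N} {N'} nf p q) =
  transport (sub σ ((ƛ M) · N) ⇛[ e ]_) (sym (sub-[] σ' M' N'))
    (pβ (noFreeBelow-sub σ-nf nf)
        (⇛-sub (exts-noFreeBelow σ-nf) (exts-⇛ σ⇛σ') p) (⇛-sub σ-nf σ⇛σ' q))

⇛-[] : ∀ {d M M' N N'} → M ⇛[ suc d ] M' → N ⇛[ d ] N' → M [ N ] ⇛[ d ] M' [ N' ]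
⇛-[] {d} {M} {M'} {N} {N'} p q =
  transport₂ _⇛[ d ]_ (sym ([]≡sub M N)) (sym ([]≡sub M' N')) (⇛-sub single-nf single-⇛ p)
  where
  single-nf : ∀ x → suc d ≤ x → NoFreeBelow d (single N x)
  single-nf (suc y) (s≤s d≤y) = noFreeBelow-var d≤y
  single-⇛ : ∀ x → single N x ⇛[ d ] single N' x
  single-⇛ zero    = q
  single-⇛ (suc y) = pvar

-- Complete development

dev : ℕ → Term → Term
dev d (var x)           = var x
dev d (ƛ M)             = ƛ dev (suc d) M
dev d (var x · N)       = var x · dev d N
dev d ((M₁ · M₂) · N)   = dev d (M₁ · M₂) · dev d N
dev d ((ƛ M) · N) with noFreeBelow? d ((ƛ M) · N)
... | yes _ = dev (suc d) M [ dev d N ]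
... | no  _ = (ƛ dev (suc d) M) · dev d N

⇛-dev : ∀ {d M M'} → M ⇛[ d ] M' → M' ⇛[ d ] dev d M
⇛-dev pvar                      = pvar
⇛-dev (plam p)                  = plam (⇛-dev p)
⇛-dev (papp pvar q)             = papp pvar (⇛-dev q)
⇛-dev (papp p@(papp _ _) q)     = papp (⇛-dev p) (⇛-dev q)
⇛-dev (papp p@(pβ _ _ _) q)     = papp (⇛-dev p) (⇛-dev q)
⇛-dev {d} (papp {N = N} (plam {M = M} p) q)
  with noFreeBelow? d ((ƛ M) · N)
... | yes nf = pβ (noFreeBelow-⇛ (papp (plam p) q) nf) (⇛-dev p) (⇛-dev q)
... | no  _  = papp (plam (⇛-dev p)) (⇛-dev q)
⇛-dev {d} (pβ {M = M} {N = N} nf p q) with noFreeBelow? d ((ƛ M) · N)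
... | yes _   = ⇛-[] (⇛-dev p) (⇛-dev q)
... | no  ¬nf = ⊥-elim (¬nf nf)

-- Confluence from the triangle property

module _ {a ℓ} {A : Set a} {_⇒_ : Rel A ℓ}
         (f : A → A) (triangle : ∀ {x y} → x ⇒ y → y ⇒ f x) where

  strip : ∀ {x y z} → x ⇒ y → Star _⇒_ x z → Σ A λ w → Star _⇒_ y w × z ⇒ w
  strip {y = y} r ε = y , ε , r
  strip r (s ◅ ss) with strip (triangle s) ss
  ... | w , ts , t = w , triangle r ◅ ts , t

  triangle⇒confluent : Confluent _⇒_
  triangle⇒confluent {C = C} ε ss = C , ss , ε
  triangle⇒confluent (r ◅ rs) ss with strip r ss
  ... | _ , ts , t with triangle⇒confluent rs ts
  ...   | w , vs , us = w , vs , t ◅ us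

module _ {a ℓ₁ ℓ₂} {A : Set a} {_⟶₁_ : Rel A ℓ₁} {_⇒_ : Rel A ℓ₂} where

  confluent-between : (∀ {x y} → x ⟶₁ y → x ⇒ y) → (∀ {x y} → x ⇒ y → Star _⟶₁_ x y) →
                      Confluent _⇒_ → Confluent _⟶₁_
  confluent-between ⟶⊆⇒ ⇒⊆⟶* conf rs ss with conf (map ⟶⊆⇒ rs) (map ⟶⊆⇒ ss)
  ... | w , rs' , ss' = w , (⇒⊆⟶* ⋆) rs' , (⇒⊆⟶* ⋆) ss'

⟶[]-confluent : ∀ d → Confluent _⟶[ d ]_
⟶[]-confluent d = confluent-between ⟶⇒⇛ ⇛⇒⟶* (triangle⇒confluent (dev d) ⇛-dev)

mainTheorem14 : ∀ {M N₁ N₂ : Term} → M ↠ N₁ → M ↠ N₂ → Σ Term (λ P → (N₁ ↠ P) × (N₂ ↠ P))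
mainTheorem14 = ⟶[]-confluent 0
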